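{- Let $p$ be a prime, let $m,n$ be positive integers, and let $A$ be an $(mp+1)\times(np+1)$ array of nonnegative integers whose top-left, top-right, bottom-left and bottom-right corner entries are $a,b,c,d$ respectively. Suppose that all $p\times p$ subarrays of $A$ formed from $p$ consecutive rows and $p$ consecutive columns have the same sum. Then $a+d=c+b$. -}

module Defs where

open import Data.Nat using (ℕ; zero; suc; _+_)

sumTo : ℕ → (ℕ → ℕ) → ℕ
sumTo zero    f = 0
sumTo (suc n) f = sumTo n f + f n

blockSum : ℕ → (ℕ → ℕ → ℕ) → ℕ → ℕ → ℕ
blockSum p A i j = sumTo p (λ k → sumTo p (λ l → A (i + k) (j + l)))

-- Moving a p×p window down one row adds the length-p segment of row i + p and
-- removes that of row i, so equal window sums make every row segment p-periodic
-- in the row index.  Moving the segment one column to the right exchanges the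
-- entries A r j and A r (j + p); comparing rows i and i + p yields
-- A i j + A (i+p) (j+p) = A (i+p) j + A i (j+p) for each p×p cell.  These cell
-- identities compose along the rows and columns of the m×n grid of cells into
-- the identity for the four corners.
module Submission where

open import Data.Nat using (ℕ; zero; suc; _+_; _*_; _≤_; _<_; s≤s)
open import Data.Nat.Primality using (Prime)
open import Data.Nat.Properties
  using (+-comm; +-assoc; +-suc; +-identityʳ; +-cancelˡ-≡; +-commutativeSemigroup;
         *-monoˡ-≤; ≤-refl; m≤n⇒m≤n+o; m<n⇒m<1+n)
open import Algebra.Properties.CommutativeSemigroup +-commutativeSemigroup using (x∙yz≈y∙xz)
open import Function using (flip)
open import Relation.Binary.PropositionalEquality
  using (_≡_; refl; sym; trans; cong; subst; subst₂; module ≡-Reasoning)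

open import Defs

open ≡-Reasoning

sumTo-slide : ∀ n (f : ℕ → ℕ) i →
              sumTo n (λ k → f (i + k)) + f (i + n) ≡ f i + sumTo n (λ k → f (suc i + k))
sumTo-slide zero    f i = trans (cong f (+-identityʳ i)) (sym (+-identityʳ (f i)))
sumTo-slide (suc n) f i = begin
  sumTo n (λ k → f (i + k)) + f (i + n) + f (i + suc n)
    ≡⟨ cong (_+ f (i + suc n)) (sumTo-slide n f i) ⟩
  f i + sumTo n (λ k → f (suc i + k)) + f (i + suc n)
    ≡⟨ +-assoc (f i) _ _ ⟩
  f i + (sumTo n (λ k → f (suc i + k)) + f (i + suc n))
    ≡⟨ cong (λ t → f i + (sumTo n (λ k → f (suc i + k)) + f t)) (+-suc i n) ⟩
  f i + sumTo (suc n) (λ k → f (suc i + k)) ∎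

record Balanced (A : ℕ → ℕ → ℕ) (i j i′ j′ : ℕ) : Set where
  constructor balanced
  field corners : A i j + A i′ j′ ≡ A i′ j + A i j′

open Balanced using (corners)

module _ {A : ℕ → ℕ → ℕ} where

  balanced-transpose : ∀ {i j i′ j′} → Balanced A i j i′ j′ → Balanced (flip A) j i j′ i′
  balanced-transpose {i} {j} {i′} {j′} (balanced e) = balanced (trans e (+-comm (A i′ j) (A i j′)))

  balanced-beside : ∀ {i i′ j j′ j″} →
                    Balanced A i j i′ j′ → Balanced A i j′ i′ j″ → Balanced A i j i′ j″
  balanced-beside {i} {i′} {j} {j′} {j″} (balanced left) (balanced right) =
    balanced (+-cancelˡ-≡ (A i j′) _ _ (begin
    A i j′ + (A i j + A i′ j″)   ≡⟨ x∙yz≈y∙xz (A i j′) (A i j) (A i′ j″) ⟩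
    A i j + (A i j′ + A i′ j″)   ≡⟨ cong (A i j +_) right ⟩
    A i j + (A i′ j′ + A i j″)   ≡⟨ +-assoc (A i j) (A i′ j′) (A i j″) ⟨
    A i j + A i′ j′ + A i j″     ≡⟨ cong (_+ A i j″) (trans left (+-comm (A i′ j) (A i j′))) ⟩
    A i j′ + A i′ j + A i j″     ≡⟨ +-assoc (A i j′) (A i′ j) (A i j″) ⟩
    A i j′ + (A i′ j + A i j″)   ∎))

balanced-below : ∀ {A i i′ i″ j j′} →
                 Balanced A i j i′ j′ → Balanced A i′ j i″ j′ → Balanced A i j i″ j′
balanced-below upper lower =
  balanced-transpose (balanced-beside (balanced-transpose upper) (balanced-transpose lower))

balanced-strip : ∀ (A : ℕ → ℕ → ℕ) i i′ (c : ℕ → ℕ) n →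
                 (∀ b → b < n → Balanced A i (c b) i′ (c (suc b))) →
                 Balanced A i (c 0) i′ (c n)
balanced-strip A i i′ c zero    cells = balanced (+-comm (A i (c 0)) (A i′ (c 0)))
balanced-strip A i i′ c (suc n) cells =
  balanced-beside (balanced-strip A i i′ c n (λ b b<n → cells b (m<n⇒m<1+n b<n))) (cells n ≤-refl)

balanced-grid : ∀ (A : ℕ → ℕ → ℕ) (r c : ℕ → ℕ) m n →
                (∀ a b → a < m → b < n → Balanced A (r a) (c b) (r (suc a)) (c (suc b))) →
                Balanced A (r 0) (c 0) (r m) (c n)
balanced-grid A r c zero    n cells = balanced refl
balanced-grid A r c (suc m) n cells =
  balanced-below (balanced-grid A r c m n (λ a b a<m → cells a b (m<n⇒m<1+n a<m)))
                 (balanced-strip A (r m) (r (suc m)) c n (λ b → cells m b ≤-refl))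

module _ (p : ℕ) (A : ℕ → ℕ → ℕ) where

  rowSum : ℕ → ℕ → ℕ
  rowSum r j = sumTo p (λ l → A r (j + l))

  rowSum-periodic : ∀ i j → blockSum p A i j ≡ blockSum p A (suc i) j →
                    rowSum (i + p) j ≡ rowSum i j
  rowSum-periodic i j same = +-cancelˡ-≡ (blockSum p A i j) _ _ (begin
    blockSum p A i j + rowSum (i + p) j   ≡⟨ sumTo-slide p (λ r → rowSum r j) i ⟩
    rowSum i j + blockSum p A (suc i) j   ≡⟨ cong (rowSum i j +_) same ⟨
    rowSum i j + blockSum p A i j         ≡⟨ +-comm (rowSum i j) _ ⟩
    blockSum p A i j + rowSum i j         ∎)

  balanced-cell : ∀ i j → blockSum p A i j ≡ blockSum p A (suc i) j →
                  blockSum p A i (suc j) ≡ blockSum p A (suc i) (suc j) →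
                  Balanced A i j (i + p) (j + p)
  balanced-cell i j same same′ = balanced (+-cancelˡ-≡ s _ _ (begin
    s + (A i j + A (i + p) (j + p))   ≡⟨ x∙yz≈y∙xz s (A i j) _ ⟩
    A i j + (s + A (i + p) (j + p))   ≡⟨ cong (A i j +_) bottom ⟩
    A i j + (A (i + p) j + t)         ≡⟨ x∙yz≈y∙xz (A i j) (A (i + p) j) t ⟩
    A (i + p) j + (A i j + t)         ≡⟨ cong (A (i + p) j +_) top ⟨
    A (i + p) j + (s + A i (j + p))   ≡⟨ x∙yz≈y∙xz (A (i + p) j) s _ ⟩
    s + (A (i + p) j + A i (j + p))   ∎))
    where
      s t : ℕ
      s = rowSum i j
      t = rowSum i (suc j)

      top : s + A i (j + p) ≡ A i j + t
      top = sumTo-slide p (A i) j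

      bottom : s + A (i + p) (j + p) ≡ A (i + p) j + t
      bottom = subst₂ (λ u v → u + A (i + p) (j + p) ≡ A (i + p) j + v)
                      (rowSum-periodic i j same) (rowSum-periodic i (suc j) same′)
                      (sumTo-slide p (A (i + p)) j)

lemma2p3 : (p m n : ℕ) → Prime p → 0 < m → 0 < n →
           (A : ℕ → ℕ → ℕ) →
           (∀ i j i′ j′ →
              i + p ≤ m * p + 1 → j + p ≤ n * p + 1 →
              i′ + p ≤ m * p + 1 → j′ + p ≤ n * p + 1 →
              blockSum p A i j ≡ blockSum p A i′ j′) →
           A 0 0 + A (m * p) (n * p) ≡ A (m * p) 0 + A 0 (n * p)
lemma2p3 p m n _ _ _ A equal-sums = corners (balanced-grid A (_* p) (_* p) m n cell)
  where
    cell-fits : ∀ {a k} → a < k → a * p + p ≤ k * p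
    cell-fits {a} {k} a<k = subst (_≤ k * p) (+-comm p (a * p)) (*-monoˡ-≤ p a<k)

    fits : ∀ {x y} → x ≤ y → x ≤ y + 1
    fits = m≤n⇒m≤n+o 1

    fits-suc : ∀ {x y} → x ≤ y → suc x ≤ y + 1
    fits-suc {x} {y} x≤y = subst (suc x ≤_) (+-comm 1 y) (s≤s x≤y)

    vertical-neighbours : ∀ i j → i + p ≤ m * p → j + p ≤ n * p + 1 →
                          blockSum p A i j ≡ blockSum p A (suc i) j
    vertical-neighbours i j i-fits j-fits =
      equal-sums i j (suc i) j (fits i-fits) j-fits (fits-suc i-fits) j-fits

    cell : ∀ a b → a < m → b < n → Balanced A (a * p) (b * p) (suc a * p) (suc b * p)
    cell a b a<m b<n =
      subst₂ (Balanced A (a * p) (b * p)) (+-comm (a * p) p) (+-comm (b * p) p)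
        (balanced-cell p A (a * p) (b * p)
          (vertical-neighbours (a * p) (b * p) (cell-fits a<m) (fits (cell-fits b<n)))
          (vertical-neighbours (a * p) (suc (b * p)) (cell-fits a<m) (fits-suc (cell-fits b<n))))
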